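{- Let $(D,r)$ be a rooted digraph reduced with respect to Rules 1–4. Let $u$ be a cut-vertex of $D$ or $u=r$. Then every private neighbour $v\in P(u)$ has in-degree $1$ and $(u,v)$ is a cut-edge. In particular, the head of any cut-edge of $D$ has in-degree $1$.
   Context: A rooted digraph $(D,r)$ is a finite digraph without loops or parallel arcs (arcs $(u,v)$ and $(v,u)$ may both be present) with a root $r$ of in-degree $0$. A cut-vertex is a vertex $v\ne r$ such that some vertex is unreachable from $r$ in $D-v$. A cut-edge is an arc $e$ such that some vertex is unreachable from $r$ in $D-e$. For $u$ a cut-vertex or $u=r$, $P(u)$ is the set of out-neighbours of $u$ not reachable from $r$ in $D-u$ (for $u=r$, all out-neighbours of $r$). $N^-(x),N^+(x)$ denote in-/out-neighbourhoods. $D$ is reduced with respect to Rules 1–4 if: (1) every vertex is reachable from $r$; (2) no cut-vertex has exactly one incoming arc and no cut-vertex has exactly one outgoing arc; (3) there are no vertices $u_1,\dots,u_5$ with $N^+(u_i)=N^-(u_i)=\{u_{i-1},u_{i+1}\}$ for $i=2,3,4$; (4) there is no vertex $x$ with an in-neighbour $y$ such that every directed path from $r$ to $y$ contains a vertex of $N^-(x)\setminus\{y\}$. -}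

module Defs where

open import Data.Nat using (ℕ)
open import Data.Bool using (Bool; true; false; T)
open import Data.Fin using (Fin)
open import Data.Fin.Properties using ()
open import Data.List using (List; []; _∷_; length; filter)
open import Data.List.Base using ()
open import Data.Fin.Base using ()
open import Data.List.Membership.Propositional using (_∈_; _∉_)
open import Data.List.Relation.Unary.Unique.Propositional using (Unique)
open import Data.Product using (Σ; ∃; _×_; _,_)
open import Data.Sum using (_⊎_)
open import Relation.Nullary using (¬_)
open import Relation.Nullary.Decidable using (T?)
open import Relation.Binary.PropositionalEquality using (_≡_; _≢_)
open import Function.Bundles using (_⇔_)
import Data.List as L
open import Data.List using (allFin)

-- Arcs are given by a Boolean
-- adjacency relation (so there are no parallel arcs; (u,v) and (v,u) may
-- both be present), there are no loops, and the root has in-degree 0.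
record RootedDigraph (n : ℕ) : Set where
  field
    arc      : Fin n → Fin n → Bool
    loopless : ∀ v → arc v v ≡ false
    root     : Fin n
    rootIn0  : ∀ v → arc v root ≡ false

open RootedDigraph public

module _ {n : ℕ} (D : RootedDigraph n) where

  data Walk : Fin n → Fin n → Set where
    [] : ∀ {x} → Walk x x
    step : ∀ {x} y {z} → arc D x y ≡ true → Walk y z → Walk x z

  verts : ∀ {x y} → Walk x y → List (Fin n)
  verts {x} [] = x ∷ []
  verts {x} (step _ _ w) = x ∷ verts w

  arcs : ∀ {x y} → Walk x y → List (Fin n × Fin n)
  arcs [] = []
  arcs {x} (step y _ w) = (x , y) ∷ arcs w

  IsPath : ∀ {x y} → Walk x y → Set
  IsPath w = Unique (verts w)

  Reachable : Fin n → Set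
  Reachable w = Walk (root D) w

  ReachableAvoidingVertex : Fin n → Fin n → Set
  ReachableAvoidingVertex v w = Σ (Walk (root D) w) λ p → v ∉ verts p

  ReachableAvoidingArc : Fin n → Fin n → Fin n → Set
  ReachableAvoidingArc a b w = Σ (Walk (root D) w) λ p → (a , b) ∉ arcs p

  IsCutVertex : Fin n → Set
  IsCutVertex v = v ≢ root D × ∃ λ w → w ≢ v × ¬ ReachableAvoidingVertex v w

  IsCutEdge : Fin n → Fin n → Set
  IsCutEdge a b = arc D a b ≡ true × ∃ λ w → ¬ ReachableAvoidingArc a b w

  OutNbr : Fin n → Fin n → Set
  OutNbr u w = arc D u w ≡ true

  InNbr : Fin n → Fin n → Set
  InNbr u w = arc D w u ≡ true

  indeg : Fin n → ℕ
  indeg v = length (filter (λ w → T? (arc D w v)) (allFin n))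

  outdeg : Fin n → ℕ
  outdeg v = length (filter (λ w → T? (arc D v w)) (allFin n))

  InP : Fin n → Fin n → Set
  InP u v = arc D u v ≡ true ×
            (u ≡ root D ⊎ (IsCutVertex u × ¬ ReachableAvoidingVertex u v))

  Rule1 : Set
  Rule1 = ∀ w → Reachable w

  Rule2 : Set
  Rule2 = ∀ v → IsCutVertex v → ¬ (indeg v ≡ 1) × ¬ (outdeg v ≡ 1)

  NbrsAre : Fin n → Fin n → Fin n → Set
  NbrsAre x a b = (∀ w → OutNbr x w ⇔ (w ≡ a ⊎ w ≡ b))
                × (∀ w → InNbr x w ⇔ (w ≡ a ⊎ w ≡ b))

  Rule3 : Set
  Rule3 = ∀ u₁ u₂ u₃ u₄ u₅ → Unique (u₁ ∷ u₂ ∷ u₃ ∷ u₄ ∷ u₅ ∷ []) →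
          ¬ (NbrsAre u₂ u₁ u₃ × NbrsAre u₃ u₂ u₄ × NbrsAre u₄ u₃ u₅)

  Rule4 : Set
  Rule4 = ∀ x y → InNbr x y →
          ¬ (∀ (p : Walk (root D) y) → IsPath p →
               ∃ λ z → z ∈ verts p × InNbr x z × z ≢ y)

  Reduced : Set
  Reduced = Rule1 × Rule2 × Rule3 × Rule4

module Submission where

-- Rule 4 forces an arc (u, v) to be the ONLY arc into v as soon
-- as u dominates every other in-neighbour y of v, i.e. every walk from the
-- root to y passes through u: otherwise the paths to y would all meet the
-- in-neighbour u ≠ y of v, which Rule 4 forbids.  A sole in-neighbour gives
-- in-degree 1, and then (u, v) is a cut-edge because every walk from the
-- root to v ≠ r must enter v through its last arc, which is (u, v).
--
-- Part 1 (private neighbours): if v ∈ P(u) and y → v with y ≠ u, a walk to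
-- y avoiding u could be extended by (y, v) to reach v in D - u; so u
-- dominates y, and the sole-in-neighbour facts apply.
-- Part 2 (heads of cut-edges): the vertices reachable in D - (a, b) are
-- closed under every arc except (a, b); if b were among them they would be
-- closed under all arcs and by Rule 1 contain every vertex, contradicting
-- that (a, b) is a cut-edge.  Hence every walk to another in-neighbour y of
-- b must use (a, b) and thus visit a, so again a dominates y.

open import Defs
open import Data.Nat using (ℕ)
open import Data.Fin using (Fin; _≟_)
open import Data.Bool using (true)
open import Data.Bool.Properties using (T-≡)
open import Data.Product using (_×_; _,_; proj₁; proj₂; ∃)
open import Data.Sum using (_⊎_; inj₁; inj₂)
open import Data.Empty using (⊥-elim)
open import Data.List using (List; []; _∷_; _++_; length; filter; allFin)
open import Data.List.Membership.Propositional using (_∈_; _∉_)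
open import Data.List.Membership.Propositional.Properties
  using (∈-++⁻; ∈-filter⁺; ∈-allFin)
open import Data.List.Relation.Unary.Any using (here; there)
open import Data.List.Relation.Unary.All as All using (All; _∷_)
open import Data.List.Relation.Unary.All.Properties using (all-filter)
open import Data.List.Relation.Unary.AllPairs using (_∷_)
open import Data.List.Relation.Unary.Unique.Propositional using (Unique)
open import Data.List.Relation.Unary.Unique.Propositional.Properties
  using (filter⁺; allFin⁺)
open import Function.Bundles using (Equivalence)
open import Relation.Nullary using (¬_; yes; no)
open import Relation.Nullary.Decidable using (T?)
open import Relation.Unary using (Pred; Decidable)
open import Relation.Binary.PropositionalEquality
  using (_≡_; _≢_; refl; sym; trans; cong)

unique-constant-length : ∀ {a} {A : Set a} {u : A} {xs : List A} →
                         Unique xs → All (_≡ u) xs → u ∈ xs → length xs ≡ 1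
unique-constant-length {xs = _ ∷ []} _ _ _ = refl
unique-constant-length {xs = _ ∷ _ ∷ _} ((x≢y ∷ _) ∷ _) (refl ∷ refl ∷ _) _ =
  ⊥-elim (x≢y refl)

-- A predicate satisfied by exactly one vertex u holds on exactly one entry
-- of allFin n.  This is how "u is the only in-neighbour" becomes indeg = 1.
count-unique-witness : ∀ {p n} {P : Pred (Fin n) p} (P? : Decidable P) (u : Fin n) →
                       P u → (∀ w → P w → w ≡ u) →
                       length (filter P? (allFin n)) ≡ 1
count-unique-witness {n = n} P? u Pu only-u =
  unique-constant-length (filter⁺ P? (allFin⁺ n))
                         (All.map (only-u _) (all-filter P? (allFin n)))
                         (∈-filter⁺ P? (∈-allFin u) Pu)

module _ {n : ℕ} (D : RootedDigraph n) where

  open import Data.List.Membership.DecPropositional (_≟_ {n}) using (_∈?_)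

  snoc : ∀ {x y z} → Walk D x y → arc D y z ≡ true → Walk D x z
  snoc []             e = step _ e []
  snoc (step y e′ w)  e = step y e′ (snoc w e)

  verts-snoc : ∀ {x y z} (p : Walk D x y) (e : arc D y z ≡ true) →
               verts D (snoc p e) ≡ verts D p ++ z ∷ []
  verts-snoc []             e = refl
  verts-snoc {x} (step _ _ w) e = cong (x ∷_) (verts-snoc w e)

  arcs-snoc : ∀ {x y z} (p : Walk D x y) (e : arc D y z ≡ true) →
              arcs D (snoc p e) ≡ arcs D p ++ (y , z) ∷ []
  arcs-snoc []             e = refl
  arcs-snoc {x} (step y _ w) e = cong ((x , y) ∷_) (arcs-snoc w e)

  snoc-avoids-vertex : ∀ {x y z u} (p : Walk D x y) (e : arc D y z ≡ true) →
                       u ∉ verts D p → u ≢ z → u ∉ verts D (snoc p e)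
  snoc-avoids-vertex p e u∉p u≢z u∈ rewrite verts-snoc p e with ∈-++⁻ (verts D p) u∈
  ... | inj₁ u∈p          = u∉p u∈p
  ... | inj₂ (here u≡z)   = u≢z u≡z

  snoc-avoids-arc : ∀ {x y z a b} (p : Walk D x y) (e : arc D y z ≡ true) →
                    (a , b) ∉ arcs D p → (a , b) ≢ (y , z) →
                    (a , b) ∉ arcs D (snoc p e)
  snoc-avoids-arc p e ab∉p ab≢yz ab∈ rewrite arcs-snoc p e with ∈-++⁻ (arcs D p) ab∈
  ... | inj₁ ab∈p          = ab∉p ab∈p
  ... | inj₂ (here ab≡yz)  = ab≢yz ab≡yz

  start∈verts : ∀ {x y} (p : Walk D x y) → x ∈ verts D p
  start∈verts []           = here refl
  start∈verts (step _ _ _) = here refl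

  arc-tail∈verts : ∀ {x y a b} (p : Walk D x y) → (a , b) ∈ arcs D p → a ∈ verts D p
  arc-tail∈verts (step _ _ w) (here refl) = here refl
  arc-tail∈verts (step _ _ w) (there m)   = there (arc-tail∈verts w m)

  last-arc : ∀ {x v} (p : Walk D x v) → x ≢ v →
             ∃ λ y → arc D y v ≡ true × (y , v) ∈ arcs D p
  last-arc [] x≢v = ⊥-elim (x≢v refl)
  last-arc {x} {v} (step y e w) x≢v with y ≟ v
  ... | yes refl = x , e , here refl
  ... | no y≢v with last-arc w y≢v
  ...   | z , e′ , m = z , e′ , there m

  arc-head≢root : ∀ {u v} → arc D u v ≡ true → root D ≢ v
  arc-head≢root {u} e refl with trans (sym e) (rootIn0 D u)
  ... | ()

  arc-ends-distinct : ∀ {u v} → arc D u v ≡ true → u ≢ v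
  arc-ends-distinct {u} e refl with trans (sym e) (loopless D u)
  ... | ()

  Dominates : Fin n → Fin n → Set
  Dominates u y = (p : Walk D (root D) y) → u ∈ verts D p

  sole-in-neighbour : Rule4 D → ∀ {u v} → arc D u v ≡ true →
                      (∀ y → arc D y v ≡ true → y ≢ u → Dominates u y) →
                      ∀ y → arc D y v ≡ true → y ≡ u
  sole-in-neighbour rule4 {u} uv dominated y yv with y ≟ u
  ... | yes y≡u = y≡u
  ... | no  y≢u = ⊥-elim (rule4 _ y yv λ p _ →
                    u , dominated y yv y≢u p , uv , λ u≡y → y≢u (sym u≡y))

  indeg-sole : ∀ {u v} → arc D u v ≡ true → (∀ y → arc D y v ≡ true → y ≡ u) →
               indeg D v ≡ 1
  indeg-sole {u} {v} uv only-u =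
    count-unique-witness (λ w → T? (arc D w v)) u
      (Equivalence.from T-≡ uv) (λ w t → only-u w (Equivalence.to T-≡ t))

  sole-in-neighbour-cut-edge : ∀ {u v} → arc D u v ≡ true →
                               (∀ y → arc D y v ≡ true → y ≡ u) → IsCutEdge D u v
  sole-in-neighbour-cut-edge {u} {v} uv only-u = uv , v , avoids-impossible
    where
    avoids-impossible : ¬ ReachableAvoidingArc D u v v
    avoids-impossible (p , uv∉p) with last-arc p (arc-head≢root uv)
    ... | y , yv , yv∈p with only-u y yv
    ...   | refl = uv∉p yv∈p

  -- Part 1: private neighbours.  If v ∈ P(u), then u dominates every
  -- in-neighbour y ≠ u of v: a walk to y avoiding u extends to v in D - u.
  private-neighbour-dominated : ∀ {u v} → InP D u v → ∀ y → arc D y v ≡ true →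
                                y ≢ u → Dominates u y
  private-neighbour-dominated (_  , inj₁ refl)            _ _  _ p = start∈verts p
  private-neighbour-dominated (uv , inj₂ (_ , v-cut-off)) y yv _ p with _ ∈? verts D p
  ... | yes u∈p = u∈p
  ... | no  u∉p = ⊥-elim (v-cut-off (snoc p yv , snoc-avoids-vertex p yv u∉p (arc-ends-distinct uv)))

  private-neighbour : Rule4 D → ∀ {u v} → InP D u v →
                      indeg D v ≡ 1 × IsCutEdge D u v
  private-neighbour rule4 inP@(uv , _) =
    indeg-sole uv only-u , sole-in-neighbour-cut-edge uv only-u
    where
    only-u : ∀ y → arc D y _ ≡ true → y ≡ _
    only-u = sole-in-neighbour rule4 uv (private-neighbour-dominated inP)

  module CutEdge (a b : Fin n) where

    Good : Fin n → Set
    Good = ReachableAvoidingArc D a b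

    good-step : ∀ {x y} → Good x → arc D x y ≡ true → (a , b) ≢ (x , y) → Good y
    good-step (p , ab∉p) e ab≢xy = snoc p e , snoc-avoids-arc p e ab∉p ab≢xy

    good-walk : Good b → ∀ {x z} → Walk D x z → Good x → Good z
    good-walk good-b []           good-x = good-x
    good-walk good-b (step y e w) good-x with y ≟ b
    ... | yes refl = good-walk good-b w good-b
    ... | no  y≢b  = good-walk good-b w (good-step good-x e λ ab≡xy → y≢b (sym (cong proj₂ ab≡xy)))

    head-cut-off : Rule1 D → IsCutEdge D a b → ¬ Good b
    head-cut-off rule1 (_ , w , w-cut-off) good-b =
      w-cut-off (good-walk good-b (rule1 w) ([] , λ ()))

    -- Hence a dominates every other in-neighbour y of b: a walk to y
    -- avoiding a avoids (a, b) and extends to b.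
    cut-edge-dominated : Rule1 D → IsCutEdge D a b → ∀ y → arc D y b ≡ true →
                         y ≢ a → Dominates a y
    cut-edge-dominated rule1 cut y yb y≢a p with a ∈? verts D p
    ... | yes a∈p = a∈p
    ... | no  a∉p = ⊥-elim (head-cut-off rule1 cut
                      (good-step (p , λ ab∈p → a∉p (arc-tail∈verts p ab∈p)) yb
                                 λ ab≡yb → y≢a (sym (cong proj₁ ab≡yb))))

  cut-edge-head : Rule1 D → Rule4 D → ∀ a b → IsCutEdge D a b → indeg D b ≡ 1
  cut-edge-head rule1 rule4 a b cut@(ab , _) =
    indeg-sole ab (sole-in-neighbour rule4 ab (CutEdge.cut-edge-dominated a b rule1 cut))

lemma11 : ∀ {n} (D : RootedDigraph n) → Reduced D →
          (∀ u → (IsCutVertex D u ⊎ u ≡ root D) → ∀ v → InP D u v →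
             indeg D v ≡ 1 × IsCutEdge D u v)
          × (∀ a b → IsCutEdge D a b → indeg D b ≡ 1)
lemma11 D (rule1 , _ , _ , rule4) =
  (λ _ _ _ inP → private-neighbour D rule4 inP) , cut-edge-head D rule1 rule4
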